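{- For every positive integer $n$, $k(n)<5\cdot n^{\log_{30}5}$.
   Context: The GKS game with parameter $n$: an adversary (Merlin) holds a permutation $\pi=\pi_1\pi_2\ldots\pi_n$ of $[n]=\{1,\ldots,n\}$ and a bit $b$. Alice has a strategy $S$ mapping partial permutations of $[n]$ (sequences $\pi_1\ldots\pi_i$ of distinct elements of $[n]$) to $\{0,1\}$, and Bob has a strategy $T:\{0,1\}^n\to 2^{[n]}$. An array $A[1..n]$ is filled as follows: for $1\le i\le n-1$, Alice sets $A[\pi_i]=S(\pi_1\ldots\pi_i)$; finally Merlin sets $A[\pi_n]=b$. Let $A_{\rm final}\in\{0,1\}^n$ be the resulting array. The pair $(S,T)$ is a valid strategy if $\pi_n\in T(A_{\rm final})$ for every permutation $\pi$ and every bit $b$. A $(k,n)$ strategy is a valid strategy $(S,T)$ for parameter $n$ such that additionally $|T(\sigma)|\le k$ for every $\sigma\in\{0,1\}^n$. $k(n)$ denotes the minimum $k$ such that a $(k,n)$ strategy exists. -}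

module Defs where

open import Data.Nat using (ℕ; zero; suc; _<_; _≤_; _^_; _+_)
import Data.Nat as ℕ
open import Data.Fin using (Fin; toℕ)
open import Data.Fin.Subset using (Subset; _∈_; ∣_∣)
open import Data.Fin.Permutation using (Permutation′; _⟨$⟩ʳ_; _⟨$⟩ˡ_)
open import Data.List using (List; take; map; allFin)
open import Data.Bool using (Bool)
open import Data.Product using (Σ; _×_; ∃; ∃-syntax)
open import Relation.Nullary using (yes; no)
open import Relation.Binary.PropositionalEquality using (_≡_)

-- A permutation π₁…πₙ of [n] is represented as π : Permutation′ n, with
-- π_{i+1} = π ⟨$⟩ʳ i  (0-based positions i : Fin n).

-- Alice's strategy: a map from (partial permutations, given as lists of
-- elements of [n]) to bits.  Only its values on lists of distinct elements
-- are ever used.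
AliceStrategy : ℕ → Set
AliceStrategy n = List (Fin n) → Bool

BobStrategy : ℕ → Set
BobStrategy n = (Fin n → Bool) → Subset n

-- The prefix π₁ … π_{j+1} of the permutation (j is 0-based).
prefix : ∀ {n} → Permutation′ n → Fin n → List (Fin n)
prefix {n} π j = take (suc (toℕ j)) (map (π ⟨$⟩ʳ_) (allFin n))

-- The final array A_final: cell x is written at the step j where π_{j+1} = x.
-- If that is the last step (j+1 = n), Merlin writes b; otherwise Alice writes
-- S(π₁ … π_{j+1}).
finalArray : ∀ {n} → AliceStrategy n → Permutation′ n → Bool → Fin n → Bool
finalArray {n} S π b x with suc (toℕ (π ⟨$⟩ˡ x)) ℕ.≟ n
... | yes _ = b
... | no  _ = S (prefix π (π ⟨$⟩ˡ x))

Valid : ∀ {n} → AliceStrategy n → BobStrategy n → Set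
Valid {n} S T = ∀ (π : Permutation′ n) (b : Bool) (last : Fin n) →
  suc (toℕ last) ≡ n → (π ⟨$⟩ʳ last) ∈ T (finalArray S π b)

KNStrategy : ℕ → ℕ → Set
KNStrategy k n = Σ (AliceStrategy n) λ S → Σ (BobStrategy n) λ T →
  Valid S T × (∀ (σ : Fin n → Bool) → ∣ T σ ∣ ≤ k)

BelowBound : ℕ → ℕ → Set
BelowBound k n = ∃[ p ] ∃[ q ] (1 ≤ q × k ^ q < 5 ^ (p + q) × 30 ^ p ≤ n ^ q)

{-# OPTIONS --safe #-}
-- Call a (k,n) strategy a bit strategy if Bob also reads a bit off the final array, and the two
-- arrays Merlin can complete the game to get different bits.  Bit strategies compose: on m blocks
-- of b cells Alice plays the inner strategy in every block, except on the last cell of a block,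
-- where she picks the value that makes the block's bit equal to the outer strategy's move for that
-- block; Bob guesses the cells guessed by both strategies, so (k₁,m) and (k₂,b) give (k₁k₂,mb).
-- A (5,6) bit strategy whose guess is a single cell whenever its bit is 0 is verified by
-- retrograde analysis.  Put under the outer strategy on 5 cells in which Alice always writes 0
-- (Bob's bit is the OR; he guesses the cells whose removal leaves only 0s), it still yields guesses
-- of at most 5 cells: a (5,30) bit strategy, hence (5^j,30^j) ones.  Restricting to n ≤ 30^j cells
-- with j least gives k(n) ≤ 5^j < 5·n^(log₃₀ 5).
module Submission where

open import Defs
open import Data.Nat using (ℕ; _≤_)
open import Data.Product using (∃-syntax; _×_)

import Data.Nat.Properties as ℕ
open import Algebra.Properties.CommutativeMonoid.Sum ℕ.+-0-commutativeMonoid using (sum-remove)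
open import Algebra.Properties.CommutativeSemigroup ℕ.*-commutativeSemigroup using (x∙yz≈y∙xz; x∙yz≈xy∙z)
open import Algebra.Properties.Monoid.Sum ℕ.+-0-monoid using (sum; sum-syntax; sum-cong-≗; sum-replicate-zero)
open import Data.Bool as Bool using (Bool; true; false; not; _∧_; _∨_; _xor_; if_then_else_; T)
open import Data.Bool.Properties using (T-∧; T-∨; T-≡; not-involutive; ¬-not)
open import Data.Empty using (⊥-elim)
open import Data.Fin as Fin using (Fin; zero; suc; toℕ; fromℕ<; _↑ˡ_; _↑ʳ_; combine; quotient; remainder)
open import Data.Fin.Patterns using (0F; 1F; 2F; 3F; 4F; 5F)
open import Data.Fin.Permutation using (Permutation′; _⟨$⟩ʳ_; _⟨$⟩ˡ_; inverseˡ; inverseʳ)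
open import Data.Fin.Properties
  using (all?; any?; suc-injective; punchInᵢ≢i; toℕ-fromℕ<; toℕ<n; toℕ-injective;
         combine-remQuot; remQuot-combine; combine-injectiveˡ; combine-injectiveʳ)
open import Data.Fin.Subset using (∣_∣)
open import Data.List as List using (List; []; _∷_; _∷ʳ_; null; take; foldl)
open import Data.List.Membership.DecPropositional (Fin._≟_ {6}) using (_∈?_)
open import Data.List.Properties using (take-suc-tabulate; foldl-∷ʳ; map-tabulate)
open import Data.Maybe using (Maybe; just; nothing; fromMaybe; is-just; is-nothing)
open import Data.Maybe.Properties using (≡-dec)
open import Data.Nat
  using (suc; zero; _+_; _*_; _∸_; _^_; _⊔_; _<_; _≤ᵇ_; z≤n; s≤s; s≤s⁻¹;
         NonZero; NonTrivial; nonTrivial⇒n>1)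
open import Data.Nat.Tactic.RingSolver using (solve-∀)
open import Data.Product using (∃; _,_; proj₁; proj₂; uncurry)
open import Data.Sum as Sum using (_⊎_; inj₁; inj₂)
open import Data.Unit using (⊤)
open import Data.Vec using (Vec; []; _∷_; tabulate; _[_]%=_)
open import Data.Vec.Functional using (updateAt; removeAt; replicate) renaming (_∷_ to _∷ᶠ_)
open import Data.Vec.Functional.Properties using (updateAt-updates; updateAt-minimal)
open import Data.Vec.Properties using (tabulate-cong; lookup⇒[]=; lookup∘tabulate)
open import Function using (_∘_; const; id; flip)
open import Function.Bundles using (Equivalence; mk⇔)
open import Relation.Binary.PropositionalEquality
open import Relation.Nullary using (Dec; yes; no; does; ¬_; ¬?; contradiction)
open import Relation.Nullary.Decidable using (decidable-stable; _×-dec_; _→-dec_; dec-true; dec-false; does-⇔)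

open Equivalence using (to)

_≟_ : (x y : Maybe Bool) → Dec (x ≡ y)
_≟_ = ≡-dec Bool._≟_

Board : ℕ → Set
Board n = Fin n → Maybe Bool

blank : ∀ {n} → Board n
blank _ = nothing

write : ∀ {n} → Board n → Fin n → Bool → Board n
write ρ a v = updateAt ρ a (const (just v))

complete : ∀ {n} → Board n → Bool → Fin n → Bool
complete ρ b c = fromMaybe b (ρ c)

LastBlank : ∀ {n} → Board n → Fin n → Set
LastBlank ρ x = ρ x ≡ nothing × (∀ c → ρ c ≡ nothing → c ≡ x)

HasBlank : ∀ {n} → Board n → Set
HasBlank ρ = ∃ λ c → ρ c ≡ nothing

hasBlank? : ∀ {n} (ρ : Board n) → Dec (HasBlank ρ)
hasBlank? ρ = any? λ c → ρ c ≟ nothing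

OtherBlank : ∀ {n} → Board n → Fin n → Set
OtherBlank ρ a = ∃ λ c → c ≢ a × ρ c ≡ nothing

otherBlank? : ∀ {n} (ρ : Board n) a → Dec (OtherBlank ρ a)
otherBlank? ρ a = any? λ c → ¬? (c Fin.≟ a) ×-dec (ρ c ≟ nothing)

write-same : ∀ {n} (ρ : Board n) a v → write ρ a v a ≡ just v
write-same ρ a v = updateAt-updates a ρ

write-other : ∀ {n} (ρ : Board n) {a c} v → c ≢ a → write ρ a v c ≡ ρ c
write-other ρ {a} {c} v = updateAt-minimal c a ρ

write-cong : ∀ {n} {ρ ρ' : Board n} → ρ ≗ ρ' → ∀ a v → write ρ a v ≗ write ρ' a v
write-cong {ρ = ρ} {ρ'} ρ≗ρ' a v c with c Fin.≟ a
... | yes refl = trans (write-same ρ a v) (sym (write-same ρ' a v))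
... | no c≢a = trans (write-other ρ v c≢a) (trans (ρ≗ρ' c) (sym (write-other ρ' v c≢a)))

write-blank : ∀ {n} (ρ : Board n) {a c} v → write ρ a v c ≡ nothing → c ≢ a × ρ c ≡ nothing
write-blank ρ {a} {c} v eq with c Fin.≟ a
... | yes refl = contradiction (trans (sym (write-same ρ a v)) eq) λ ()
... | no c≢a   = c≢a , trans (sym (write-other ρ v c≢a)) eq

complete-cong : ∀ {n} {ρ ρ' : Board n} → ρ ≗ ρ' → ∀ b → complete ρ b ≗ complete ρ' b
complete-cong ρ≗ρ' b c = cong (fromMaybe b) (ρ≗ρ' c)

complete-filled : ∀ {n} (ρ : Board n) {c} → ρ c ≢ nothing → ∀ b b' → complete ρ b c ≡ complete ρ b' c
complete-filled ρ {c} filled b b' with ρ c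
... | just _  = refl
... | nothing = contradiction refl filled

complete-full : ∀ {n} {ρ : Board n} → ¬ HasBlank ρ → ∀ b b' → complete ρ b ≗ complete ρ b'
complete-full {ρ = ρ} full b b' c = complete-filled ρ (λ ρc → full (c , ρc)) b b'

complete-write-last : ∀ {n} {ρ : Board n} {a} → LastBlank ρ a →
                      ∀ v b → complete (write ρ a v) b ≗ complete ρ v
complete-write-last {ρ = ρ} {a} (ρa , only) v b c with c Fin.≟ a
... | yes refl = trans (cong (fromMaybe b) (write-same ρ a v)) (sym (cong (fromMaybe v) ρa))
... | no c≢a   = trans (cong (fromMaybe b) (write-other ρ v c≢a))
                       (complete-filled ρ (c≢a ∘ only c) b v)

lastBlank : ∀ {n} {ρ : Board n} {a} → ρ a ≡ nothing → ¬ OtherBlank ρ a → LastBlank ρ a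
lastBlank {a = a} ρa alone = ρa , λ c ρc → decidable-stable (c Fin.≟ a) λ c≢a → alone (c , c≢a , ρc)

HasBlank-resp : ∀ {n} {ρ ρ' : Board n} → ρ ≗ ρ' → HasBlank ρ → HasBlank ρ'
HasBlank-resp ρ≗ρ' (c , ρc) = c , trans (sym (ρ≗ρ' c)) ρc

T-∧-∧-xor : ∀ {g₀ g₁ b₁ b₀} → T (g₀ ∧ g₁ ∧ (b₁ xor b₀)) → T g₀ × T g₁ × b₁ ≡ not b₀
T-∧-∧-xor {true} {true} {true}  {false} _ = _ , _ , refl
T-∧-∧-xor {true} {true} {false} {true}  _ = _ , _ , refl
T-∧-∧-xor {false} ()
T-∧-∧-xor {true} {false} ()
T-∧-∧-xor {true} {true} {true}  {true}  ()
T-∧-∧-xor {true} {true} {false} {false} ()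

xor-steer : ∀ (f : Bool → Bool) → f true ≡ not (f false) → ∀ γ → f (f false xor γ) ≡ γ
xor-steer f flips γ with f false in f₀
xor-steer f flips false | false = f₀
xor-steer f flips true  | false = flips
xor-steer f flips false | true  = flips
xor-steer f flips true  | true  = f₀

flip-not : ∀ (f : Bool → Bool) → f true ≡ not (f false) → ∀ x → f (not x) ≡ not (f x)
flip-not f flips false = flips
flip-not f flips true  = trans (sym (not-involutive (f false))) (cong not (sym flips))

every : ∀ {n} → (Fin n → Bool) → Bool
every {zero}  p = true
every {suc n} p = p zero ∧ every (p ∘ suc)

every-sound : ∀ {n} {p : Fin n → Bool} → T (every p) → ∀ a → T (p a)
every-sound {suc n} all-p zero    = proj₁ (T-∧ .to all-p)
every-sound {suc n} all-p (suc a) = every-sound (proj₂ (T-∧ .to all-p)) a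

every-cong : ∀ {n} {p q : Fin n → Bool} → p ≗ q → every p ≡ every q
every-cong {zero}  p≗q = refl
every-cong {suc n} p≗q = cong₂ _∧_ (p≗q zero) (every-cong (p≗q ∘ suc))

everyVec : ∀ n → (Vec Bool n → Bool) → Bool
everyVec zero    P = P []
everyVec (suc n) P = everyVec n (P ∘ (false ∷_)) ∧ everyVec n (P ∘ (true ∷_))

everyVec-sound : ∀ {n} {P : Vec Bool n → Bool} → T (everyVec n P) → ∀ v → T (P v)
everyVec-sound {zero}  t []          = t
everyVec-sound {suc n} t (false ∷ v) = everyVec-sound (proj₁ (T-∧ .to t)) v
everyVec-sound {suc n} t (true  ∷ v) = everyVec-sound (proj₂ (T-∧ .to t)) v

indicator : Bool → ℕ
indicator b = if b then 1 else 0

count : ∀ {n} → (Fin n → Bool) → ℕ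
count {n} p = ∑[ i < n ] indicator (p i)

count-cong : ∀ {n} {p q : Fin n → Bool} → p ≗ q → count p ≡ count q
count-cong p≗q = sum-cong-≗ (cong indicator ∘ p≗q)

count-none : ∀ {n} {p : Fin n → Bool} → (∀ c → p c ≡ false) → count p ≡ 0
count-none {n} none = trans (count-cong none) (sum-replicate-zero n)

count-remove : ∀ {n} {p q : Fin n → Bool} a → p a ≡ true → q a ≡ false →
               (∀ c → c ≢ a → q c ≡ p c) → count p ≡ suc (count q)
count-remove {suc n} {p} {q} zero pa qa rest rewrite pa | qa =
  cong suc (sym (count-cong (λ c → rest (suc c) λ ())))
count-remove {suc n} {p} {q} (suc a) pa qa rest =
  begin
    indicator (p zero) + count (p ∘ suc)
  ≡⟨ cong₂ _+_ (cong indicator (sym (rest zero λ ())))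
               (count-remove a pa qa (λ c c≢a → rest (suc c) (c≢a ∘ suc-injective))) ⟩
    indicator (q zero) + suc (count (q ∘ suc))
  ≡⟨ ℕ.+-suc (indicator (q zero)) _ ⟩
    suc (count q)
  ∎
  where open ≡-Reasoning

count≤n : ∀ {n} (p : Fin n → Bool) → count p ≤ n
count≤n {zero}  p = z≤n
count≤n {suc n} p with p zero
... | true  = s≤s (count≤n (p ∘ suc))
... | false = ℕ.m≤n⇒m≤1+n (count≤n (p ∘ suc))

count-∧ : ∀ {n} x (p : Fin n → Bool) → count (λ c → x ∧ p c) ≡ (if x then count p else 0)
count-∧     true  p = refl
count-∧ {n} false p = count-none {n} λ _ → refl

∣tabulate∣≡count : ∀ {n} (p : Fin n → Bool) → ∣ tabulate p ∣ ≡ count p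
∣tabulate∣≡count {zero}  p = refl
∣tabulate∣≡count {suc n} p with p zero
... | true  = cong suc (∣tabulate∣≡count (p ∘ suc))
... | false = ∣tabulate∣≡count (p ∘ suc)

sum-↑ : ∀ p {q} (f : Fin (p + q) → ℕ) → sum f ≡ sum (f ∘ (_↑ˡ q)) + sum (f ∘ (p ↑ʳ_))
sum-↑ zero    f = refl
sum-↑ (suc p) f = trans (cong (f zero +_) (sum-↑ p (f ∘ suc))) (sym (ℕ.+-assoc (f zero) _ _))

sum-combine : ∀ m {n} (f : Fin (m * n) → ℕ) → sum f ≡ ∑[ i < m ] sum (f ∘ combine i)
sum-combine zero    f = refl
sum-combine (suc m) {n} f =
  trans (sum-↑ n f) (cong (sum (f ∘ combine {suc m} {n} zero) +_) (sum-combine m (f ∘ (n ↑ʳ_))))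

sum-single : ∀ {n} (f : Fin n → ℕ) i₀ → (∀ i → i ≢ i₀ → f i ≡ 0) → sum f ≡ f i₀
sum-single {suc n} f i₀ elsewhere = begin
  sum f                         ≡⟨ sum-remove f ⟩
  f i₀ + sum (removeAt f i₀)    ≡⟨ cong (f i₀ +_) (sum-cong-≗ λ j → elsewhere _ (punchInᵢ≢i i₀ j)) ⟩
  f i₀ + sum (replicate n 0)    ≡⟨ cong (f i₀ +_) (sum-replicate-zero n) ⟩
  f i₀ + 0                      ≡⟨ ℕ.+-identityʳ (f i₀) ⟩
  f i₀                          ∎
  where open ≡-Reasoning

sum-select-≤ : ∀ {n k} (p : Fin n → Bool) (f : Fin n → ℕ) → (∀ i → f i ≤ k) →
               ∑[ i < n ] (if p i then f i else 0) ≤ count p * k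
sum-select-≤ {zero}  p f f≤k = z≤n
sum-select-≤ {suc n} p f f≤k with p zero
... | true  = ℕ.+-mono-≤ (f≤k zero) (sum-select-≤ (p ∘ suc) (f ∘ suc) (f≤k ∘ suc))
... | false = sum-select-≤ (p ∘ suc) (f ∘ suc) (f≤k ∘ suc)

record BitStrategy (n k : ℕ) : Set₁ where
  field
    Safe        : Board n → Set
    safe-resp   : ∀ {ρ ρ'} → ρ ≗ ρ' → Safe ρ → Safe ρ'
    safe-blank  : Safe blank
    move        : Board n → Fin n → Bool
    safe-move   : ∀ {ρ a c} → Safe ρ → ρ a ≡ nothing → ρ c ≡ nothing → c ≢ a →
                  Safe (write ρ a (move ρ a))
    guess       : (Fin n → Bool) → Fin n → Bool
    guess-cong  : ∀ {σ σ'} → σ ≗ σ' → guess σ ≗ guess σ'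
    bit         : (Fin n → Bool) → Bool
    bit-cong    : ∀ {σ σ'} → σ ≗ σ' → bit σ ≡ bit σ'
    guess-last  : ∀ {ρ x} → Safe ρ → LastBlank ρ x → ∀ b → guess (complete ρ b) x ≡ true
    bit-last    : ∀ {ρ x} → Safe ρ → LastBlank ρ x → bit (complete ρ true) ≡ not (bit (complete ρ false))
    guess-size  : ∀ σ → count (guess σ) ≤ k

Focused : ∀ {n k} → BitStrategy n k → Set
Focused S = ∀ σ → bit σ ≡ false → count (guess σ) ≤ 1
  where open BitStrategy S

module Play {n k} (S : BitStrategy n k) where
  open BitStrategy S

  play : Board n → Fin n → Board n
  play ρ a = write ρ a (move ρ a)

  aliceFrom : Board n → List (Fin n) → Bool
  aliceFrom ρ []           = false  -- never used: prefixes are nonempty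
  aliceFrom ρ (a ∷ [])     = move ρ a
  aliceFrom ρ (a ∷ b ∷ as) = aliceFrom (play ρ a) (b ∷ as)

  aliceFrom-∷ʳ : ∀ ρ as a → aliceFrom ρ (as ∷ʳ a) ≡ move (foldl play ρ as) a
  aliceFrom-∷ʳ ρ []           a = refl
  aliceFrom-∷ʳ ρ (b ∷ [])     a = refl
  aliceFrom-∷ʳ ρ (b ∷ c ∷ as) a = aliceFrom-∷ʳ (play ρ b) (c ∷ as) a

  alice : AliceStrategy n
  alice = aliceFrom blank

  bob : BobStrategy n
  bob σ = tabulate (guess σ)

  module Run (π : Permutation′ n) where

    cell : Fin n → Fin n
    cell i = π ⟨$⟩ʳ i

    cell-injective : ∀ {i j} → cell i ≡ cell j → i ≡ j
    cell-injective eq = trans (sym (inverseˡ π)) (trans (cong (π ⟨$⟩ˡ_) eq) (inverseˡ π))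

    order : List (Fin n)
    order = List.tabulate cell

    after : ℕ → Board n
    after t = foldl play blank (take t order)

    alice-prefix : ∀ i → alice (prefix π i) ≡ move (after (toℕ i)) (cell i)
    alice-prefix i = begin
      alice (prefix π i)                    ≡⟨ cong (alice ∘ take (suc (toℕ i))) (map-tabulate id cell) ⟩
      alice (take (suc (toℕ i)) order)      ≡⟨ cong alice (take-suc-tabulate cell i) ⟩
      alice (take (toℕ i) order ∷ʳ cell i)  ≡⟨ aliceFrom-∷ʳ blank (take (toℕ i) order) (cell i) ⟩
      move (after (toℕ i)) (cell i)         ∎
      where open ≡-Reasoning

    after-step : ∀ i → after (suc (toℕ i)) ≡ play (after (toℕ i)) (cell i)
    after-step i = trans (cong (foldl play blank) (take-suc-tabulate cell i))
                         (foldl-∷ʳ play blank (cell i) (take (toℕ i) order))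

    after-suc : ∀ {t} (t<n : t < n) → after (suc t) ≡ play (after t) (cell (fromℕ< t<n))
    after-suc t<n = subst (λ s → after (suc s) ≡ play (after s) (cell (fromℕ< t<n)))
                          (toℕ-fromℕ< t<n) (after-step (fromℕ< t<n))

    unplayed : ∀ t i → t ≤ toℕ i → after t (cell i) ≡ nothing
    unplayed zero    i _   = refl
    unplayed (suc t) i t<i = begin
      after (suc t) (cell i)           ≡⟨ cong-app (after-suc t<n) (cell i) ⟩
      play (after t) (cell j) (cell i) ≡⟨ write-other (after t) _ (j≢i ∘ sym ∘ cell-injective) ⟩
      after t (cell i)                 ≡⟨ unplayed t i (ℕ.<⇒≤ t<i) ⟩
      nothing                          ∎
      where
      open ≡-Reasoning
      t<n = ℕ.<-trans t<i (toℕ<n i)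
      j = fromℕ< t<n
      j≢i : j ≢ i
      j≢i j≡i = ℕ.<-irrefl (trans (sym (toℕ-fromℕ< t<n)) (cong toℕ j≡i)) t<i

    played : ∀ t i → t ≤ n → toℕ i < t → after t (cell i) ≡ just (alice (prefix π i))
    played (suc t) i t<n i≤t with toℕ i ℕ.≟ t
    ... | yes refl = begin
      after (suc (toℕ i)) (cell i)             ≡⟨ cong-app (after-step i) (cell i) ⟩
      play (after (toℕ i)) (cell i) (cell i)   ≡⟨ write-same (after (toℕ i)) (cell i) _ ⟩
      just (move (after (toℕ i)) (cell i))     ≡⟨ cong just (sym (alice-prefix i)) ⟩
      just (alice (prefix π i))                ∎
      where open ≡-Reasoning
    ... | no i≢t = begin
      after (suc t) (cell i)           ≡⟨ cong-app (after-suc t<n) (cell i) ⟩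
      play (after t) (cell j) (cell i) ≡⟨ write-other (after t) _ (j≢i ∘ sym ∘ cell-injective) ⟩
      after t (cell i)                 ≡⟨ played t i (ℕ.<⇒≤ t<n) (ℕ.≤∧≢⇒< (s≤s⁻¹ i≤t) i≢t) ⟩
      just (alice (prefix π i))        ∎
      where
      open ≡-Reasoning
      j = fromℕ< t<n
      j≢i : j ≢ i
      j≢i j≡i = i≢t (trans (cong toℕ (sym j≡i)) (toℕ-fromℕ< t<n))

    safe-after : ∀ t → t < n → Safe (after t)
    safe-after zero    _     = safe-blank
    safe-after (suc t) 1+t<n = subst Safe (sym (after-suc t<n))
      (safe-move (safe-after t t<n) (unplayed t j (ℕ.≤-reflexive (sym (toℕ-fromℕ< t<n))))
                 (unplayed t j′ (subst (t ≤_) (sym (toℕ-fromℕ< 1+t<n)) (ℕ.n≤1+n t))) j′≢j)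
      where
      t<n = ℕ.<⇒≤ 1+t<n
      j  = fromℕ< t<n
      j′ = fromℕ< 1+t<n
      j′≢j : cell j′ ≢ cell j
      j′≢j eq = ℕ.1+n≢n (trans (sym (toℕ-fromℕ< 1+t<n))
                               (trans (cong toℕ (cell-injective eq)) (toℕ-fromℕ< t<n)))

    module Ending (last : Fin n) (1+last≡n : suc (toℕ last) ≡ n) where
      t = toℕ last
      t<n : t < n
      t<n = ℕ.≤-reflexive 1+last≡n

      index : Fin n → Fin n
      index c = π ⟨$⟩ˡ c

      at-most-last : ∀ i → toℕ i ≤ t
      at-most-last i = s≤s⁻¹ (subst (toℕ i <_) (sym 1+last≡n) (toℕ<n i))

      later-is-last : ∀ i → ¬ (toℕ i < t) → i ≡ last
      later-is-last i i≮t = toℕ-injective (ℕ.≤-antisym (at-most-last i) (ℕ.≮⇒≥ i≮t))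

      last-blank : LastBlank (after t) (cell last)
      last-blank = unplayed t last ℕ.≤-refl , only
        where
        only : ∀ c → after t c ≡ nothing → c ≡ cell last
        only c blank-c with toℕ (index c) ℕ.<? t
        ... | yes i<t = contradiction (trans (sym (played t (index c) (ℕ.<⇒≤ t<n) i<t))
                                             (trans (cong (after t) (inverseʳ π)) blank-c)) λ ()
        ... | no  i≮t = trans (sym (inverseʳ π)) (cong cell (later-is-last (index c) i≮t))

      final-complete : ∀ b → finalArray alice π b ≗ complete (after t) b
      final-complete b c with suc (toℕ (index c)) ℕ.≟ n
      ... | yes 1+i≡n = cong (fromMaybe b) (sym (trans (cong (after t) c≡last) (proj₁ last-blank)))
        where
        c≡last : c ≡ cell last
        c≡last = trans (sym (inverseʳ π))
                       (cong cell (toℕ-injective (ℕ.suc-injective (trans 1+i≡n (sym 1+last≡n)))))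
      ... | no 1+i≢n = cong (fromMaybe b) (sym (trans (cong (after t) (sym (inverseʳ π)))
                                              (played t (index c) (ℕ.<⇒≤ t<n) i<t)))
        where
        i<t : toℕ (index c) < t
        i<t = ℕ.≤∧≢⇒< (at-most-last (index c)) (λ i≡t → 1+i≢n (trans (cong suc i≡t) 1+last≡n))

  valid : Valid alice bob
  valid π b last 1+last≡n =
    lookup⇒[]= x (tabulate (guess σ)) (trans (lookup∘tabulate (guess σ) x) guessed)
    where
    open Run π
    open Ending last 1+last≡n
    x = cell last
    σ = finalArray alice π b
    guessed : guess σ x ≡ true
    guessed = trans (guess-cong (final-complete b) x) (guess-last (safe-after t t<n) last-blank b)

toKNStrategy : ∀ {n k} → BitStrategy n k → KNStrategy k n
toKNStrategy {k = k} S =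
  alice , bob , valid , λ σ → subst (_≤ k) (sym (∣tabulate∣≡count (guess σ))) (guess-size σ)
  where
  open BitStrategy S
  open Play S

single : BitStrategy 1 1
single = record
  { Safe        = λ _ → ⊤
  ; safe-resp   = _
  ; safe-blank  = _
  ; move        = λ _ _ → false
  ; safe-move   = λ { {a = zero} {c = zero} _ _ _ c≢a → contradiction refl c≢a }
  ; guess       = λ _ _ → true
  ; guess-cong  = λ _ _ → refl
  ; bit         = λ σ → σ zero
  ; bit-cong    = λ σ≗σ' → σ≗σ' zero
  ; guess-last  = λ _ _ _ → refl
  ; bit-last    = λ { {ρ} {zero} _ (ρ0 , _) → only-cell {ρ} ρ0 }
  ; guess-size  = λ _ → ℕ.≤-refl
  }
  where
  only-cell : ∀ {ρ : Board 1} → ρ zero ≡ nothing → complete ρ true zero ≡ not (complete ρ false zero)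
  only-cell ρ0 rewrite ρ0 = refl

module _ {n k} (S : BitStrategy (suc (suc n)) k) where
  private
    module S = BitStrategy S
    first = S.move blank zero

    cons-cong : ∀ {A : Set} {x : A} {f g : Fin (suc n) → A} → f ≗ g → (x ∷ᶠ f) ≗ (x ∷ᶠ g)
    cons-cong f≗g zero    = refl
    cons-cong f≗g (suc c) = f≗g c

    Safe : Board (suc n) → Set
    Safe ρ = S.Safe (just first ∷ᶠ ρ)

    complete-cons : ∀ (ρ : Board (suc n)) b → complete (just first ∷ᶠ ρ) b ≗ first ∷ᶠ complete ρ b
    complete-cons ρ b zero    = refl
    complete-cons ρ b (suc c) = refl

    last-blank : ∀ {ρ : Board (suc n)} {x} → LastBlank ρ x → LastBlank (just first ∷ᶠ ρ) (suc x)
    last-blank (ρx , only) = ρx , λ { zero () ; (suc c) ρc → cong suc (only c ρc) }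

  dropFirst : BitStrategy (suc n) k
  dropFirst = record
    { Safe        = Safe
    ; safe-resp   = S.safe-resp ∘ cons-cong
    ; safe-blank  = S.safe-resp (λ { zero → refl ; (suc c) → refl })
                      (S.safe-move {blank} {zero} {1F} S.safe-blank refl refl λ ())
    ; move        = λ ρ a → S.move (just first ∷ᶠ ρ) (suc a)
    ; safe-move   = λ {ρ} {a} {c} safe ρa ρc c≢a →
                      S.safe-resp (λ { zero → refl ; (suc c) → refl })
                        (S.safe-move {c = suc c} safe ρa ρc (c≢a ∘ suc-injective))
    ; guess       = λ σ a → S.guess (first ∷ᶠ σ) (suc a)
    ; guess-cong  = λ σ≗σ' a → S.guess-cong (cons-cong σ≗σ') (suc a)
    ; bit         = λ σ → S.bit (first ∷ᶠ σ)
    ; bit-cong    = S.bit-cong ∘ cons-cong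
    ; guess-last  = λ {ρ} {x} safe last b → trans (sym (S.guess-cong (complete-cons ρ b) (suc x)))
                                                  (S.guess-last safe (last-blank last) b)
    ; bit-last    = λ {ρ} safe last → trans (sym (S.bit-cong (complete-cons ρ true)))
                                        (trans (S.bit-last safe (last-blank last))
                                               (cong not (S.bit-cong (complete-cons ρ false))))
    ; guess-size  = λ σ → ℕ.≤-trans (ℕ.m≤n+m _ (indicator (S.guess (first ∷ᶠ σ) zero)))
                                    (S.guess-size (first ∷ᶠ σ))
    }

dropCells : ∀ d {n k} → BitStrategy (suc (d + n)) k → BitStrategy (suc n) k
dropCells zero    S = S
dropCells (suc d) S = dropCells d (dropFirst S)

restrict : ∀ {n N k} → suc n ≤ N → BitStrategy N k → BitStrategy (suc n) k
restrict {n} {N} {k} 1+n≤N S = dropCells (N ∸ suc n) (subst (λ m → BitStrategy m k) N≡ S)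
  where
  N≡ : N ≡ suc (N ∸ suc n + n)
  N≡ = trans (sym (ℕ.m∸n+n≡m 1+n≤N)) (ℕ.+-suc (N ∸ suc n) n)

module Compose {m b k₁ k₂} (O : BitStrategy m k₁) (I : BitStrategy (suc b) k₂) where
  private
    module O = BitStrategy O
    module I = BitStrategy I

  N = m * suc b

  block : ∀ {A : Set} → (Fin N → A) → Fin m → Fin (suc b) → A
  block f i = f ∘ combine i

  blockOf : Fin N → Fin m
  blockOf = quotient (suc b)

  posOf : Fin N → Fin (suc b)
  posOf = remainder {m} (suc b)

  combine-blockOf-posOf : ∀ c → combine (blockOf c) (posOf c) ≡ c
  combine-blockOf-posOf = combine-remQuot {m} (suc b)

  blockBits : (Fin N → Bool) → Fin m → Bool
  blockBits σ i = I.bit (block σ i)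

  summary : Board N → Board m
  summary ρ i with hasBlank? (block ρ i)
  ... | yes _ = nothing
  ... | no  _ = just (I.bit (complete (block ρ i) false))

  summary-blank : ∀ {ρ i} → HasBlank (block ρ i) → summary ρ i ≡ nothing
  summary-blank {ρ} {i} h with hasBlank? (block ρ i)
  ... | yes _ = refl
  ... | no ¬h = contradiction h ¬h

  summary-full : ∀ {ρ i} → ¬ HasBlank (block ρ i) → summary ρ i ≡ just (I.bit (complete (block ρ i) false))
  summary-full {ρ} {i} ¬h with hasBlank? (block ρ i)
  ... | yes h = contradiction h ¬h
  ... | no _  = refl

  summary-nothing : ∀ {ρ i} → summary ρ i ≡ nothing → HasBlank (block ρ i)
  summary-nothing {ρ} {i} eq with hasBlank? (block ρ i)
  ... | yes h = h
  ... | no _  = contradiction eq λ ()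

  summary-cong : ∀ {ρ ρ' i} → block ρ i ≗ block ρ' i → summary ρ i ≡ summary ρ' i
  summary-cong {ρ} {ρ'} {i} ρᵢ≗ρ'ᵢ with hasBlank? (block ρ i)
  ... | yes h  = sym (summary-blank (HasBlank-resp ρᵢ≗ρ'ᵢ h))
  ... | no ¬h  = sym (trans (summary-full (¬h ∘ HasBlank-resp (sym ∘ ρᵢ≗ρ'ᵢ)))
                            (cong just (I.bit-cong (complete-cong (sym ∘ ρᵢ≗ρ'ᵢ) false))))

  block-write-same : ∀ ρ i j v → block (write ρ (combine i j) v) i ≗ write (block ρ i) j v
  block-write-same ρ i j v j' with j' Fin.≟ j
  ... | yes refl = trans (write-same ρ _ v) (sym (write-same (block ρ i) j v))
  ... | no j'≢j  = trans (write-other ρ v (j'≢j ∘ combine-injectiveʳ i j' i j))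
                         (sym (write-other (block ρ i) v j'≢j))

  block-write-other : ∀ ρ {i i'} j v → i' ≢ i → block (write ρ (combine i j) v) i' ≗ block ρ i'
  block-write-other ρ {i} {i'} j v i'≢i j' = write-other ρ v (i'≢i ∘ combine-injectiveˡ i' j' i j)

  Safe : Board N → Set
  Safe ρ = (∀ i → HasBlank (block ρ i) → I.Safe (block ρ i)) × O.Safe (summary ρ)

  moveAt : Board N → Fin m → Fin (suc b) → Bool
  moveAt ρ i j with otherBlank? (block ρ i) j
  ... | yes _ = I.move (block ρ i) j
  ... | no  _ = I.bit (complete (block ρ i) false) xor O.move (summary ρ) i  -- block bit := O's move, by xor-steer

  move : Board N → Fin N → Bool
  move ρ c = moveAt ρ (blockOf c) (posOf c)

  module Write {ρ : Board N} (safe : Safe ρ) (i : Fin m) (j : Fin (suc b)) (v : Bool) where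
    ρ' = write ρ (combine i j) v

    others-safe : ∀ i' → i' ≢ i → HasBlank (block ρ' i') → I.Safe (block ρ' i')
    others-safe i' i'≢i h = I.safe-resp (sym ∘ block-write-other ρ j v i'≢i)
                                        (proj₁ safe i' (HasBlank-resp (block-write-other ρ j v i'≢i) h))

    others-summary : ∀ i' → i' ≢ i → summary ρ' i' ≡ summary ρ i'
    others-summary i' i'≢i = summary-cong (block-write-other ρ j v i'≢i)

  safe-inner-move : ∀ {ρ i j} → Safe ρ → block ρ i j ≡ nothing → OtherBlank (block ρ i) j →
                    Safe (write ρ (combine i j) (I.move (block ρ i) j))
  safe-inner-move {ρ} {i} {j} safe ρij (j' , j'≢j , ρij') = inner , O.safe-resp same-summary (proj₂ safe)
    where
    v = I.move (block ρ i) j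
    open Write safe i j v
    inner : ∀ i' → HasBlank (block ρ' i') → I.Safe (block ρ' i')
    inner i' h with i' Fin.≟ i
    ... | yes refl = I.safe-resp (sym ∘ block-write-same ρ i j v)
                                 (I.safe-move (proj₁ safe i (j , ρij)) ρij ρij' j'≢j)
    ... | no i'≢i  = others-safe i' i'≢i h
    same-summary : summary ρ ≗ summary ρ'
    same-summary i' with i' Fin.≟ i
    ... | yes refl = trans (summary-blank (j , ρij))
                           (sym (summary-blank (j' , trans (block-write-same ρ i j v j')
                                                           (trans (write-other (block ρ i) v j'≢j) ρij'))))
    ... | no i'≢i  = sym (others-summary i' i'≢i)

  safe-closing-move : ∀ {ρ i j c} → Safe ρ → block ρ i j ≡ nothing → ¬ OtherBlank (block ρ i) j →
                      ρ c ≡ nothing → c ≢ combine i j →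
                      Safe (write ρ (combine i j) (I.bit (complete (block ρ i) false) xor O.move (summary ρ) i))
  safe-closing-move {ρ} {i} {j} {c} safe ρij alone ρc c≢ij =
    inner , O.safe-resp new-summary (O.safe-move (proj₂ safe) (summary-blank (j , ρij))
                                                 (summary-blank (posOf c , ρc')) c-elsewhere)
    where
    γ = O.move (summary ρ) i
    v = I.bit (complete (block ρ i) false) xor γ
    open Write safe i j v
    last : LastBlank (block ρ i) j
    last = lastBlank ρij alone
    full : ¬ HasBlank (block ρ' i)
    full (j' , ρ'ij') = alone (j' , write-blank (block ρ i) v (trans (sym (block-write-same ρ i j v j')) ρ'ij'))
    inner : ∀ i' → HasBlank (block ρ' i') → I.Safe (block ρ' i')
    inner i' h with i' Fin.≟ i
    ... | yes refl = contradiction h full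
    ... | no i'≢i  = others-safe i' i'≢i h
    steered : I.bit (complete (block ρ' i) false) ≡ γ
    steered = begin
      I.bit (complete (block ρ' i) false)           ≡⟨ I.bit-cong (complete-cong (block-write-same ρ i j v) false) ⟩
      I.bit (complete (write (block ρ i) j v) false) ≡⟨ I.bit-cong (complete-write-last last v false) ⟩
      I.bit (complete (block ρ i) v)                ≡⟨ xor-steer (I.bit ∘ complete (block ρ i))
                                                                 (I.bit-last (proj₁ safe i (j , ρij)) last) γ ⟩
      γ                                             ∎
      where open ≡-Reasoning
    new-summary : write (summary ρ) i γ ≗ summary ρ'
    new-summary i' with i' Fin.≟ i
    ... | yes refl = trans (write-same (summary ρ) i γ) (sym (trans (summary-full full) (cong just steered)))
    ... | no i'≢i  = trans (write-other (summary ρ) γ i'≢i) (sym (others-summary i' i'≢i))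
    ρc' : block ρ (blockOf c) (posOf c) ≡ nothing
    ρc' = trans (cong ρ (combine-blockOf-posOf c)) ρc
    c-elsewhere : blockOf c ≢ i
    c-elsewhere eq = c≢ij (trans (sym (combine-blockOf-posOf c)) (cong₂ combine eq (proj₂ last (posOf c) ρic)))
      where
      ρic : block ρ i (posOf c) ≡ nothing
      ρic = subst (λ i' → block ρ i' (posOf c) ≡ nothing) eq ρc'

  safe-moveAt : ∀ {ρ i j c} → Safe ρ → block ρ i j ≡ nothing → ρ c ≡ nothing → c ≢ combine i j →
                Safe (write ρ (combine i j) (moveAt ρ i j))
  safe-moveAt {ρ} {i} {j} safe ρij ρc c≢ij with otherBlank? (block ρ i) j
  ... | yes other = safe-inner-move safe ρij other
  ... | no  alone = safe-closing-move safe ρij alone ρc c≢ij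

  safe-move : ∀ {ρ a c} → Safe ρ → ρ a ≡ nothing → ρ c ≡ nothing → c ≢ a → Safe (write ρ a (move ρ a))
  safe-move {ρ} {a} safe ρa ρc c≢a = subst (λ a' → Safe (write ρ a' (move ρ a))) (combine-blockOf-posOf a)
    (safe-moveAt safe (trans (cong ρ (combine-blockOf-posOf a)) ρa) ρc
                      (c≢a ∘ flip trans (combine-blockOf-posOf a)))

  guessAt : (Fin N → Bool) → Fin m → Fin (suc b) → Bool
  guessAt σ i j = O.guess (blockBits σ) i ∧ I.guess (block σ i) j

  guess : (Fin N → Bool) → Fin N → Bool
  guess σ c = guessAt σ (blockOf c) (posOf c)

  bit : (Fin N → Bool) → Bool
  bit σ = O.bit (blockBits σ)

  blockBits-cong : ∀ {σ σ'} → σ ≗ σ' → blockBits σ ≗ blockBits σ'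
  blockBits-cong σ≗σ' i = I.bit-cong (σ≗σ' ∘ combine i)

  module Last {ρ x} (safe : Safe ρ) (last : LastBlank ρ x) where
    i = blockOf x
    j = posOf x

    ρij : block ρ i j ≡ nothing
    ρij = trans (cong ρ (combine-blockOf-posOf x)) (proj₁ last)

    is-x : ∀ {i' j'} → block ρ i' j' ≡ nothing → combine i' j' ≡ combine i j
    is-x e = trans (proj₂ last _ e) (sym (combine-blockOf-posOf x))

    inner-last : LastBlank (block ρ i) j
    inner-last = ρij , λ j' e → combine-injectiveʳ i j' i j (is-x e)

    outer-last : LastBlank (summary ρ) i
    outer-last = summary-blank {ρ} {i} (j , ρij) , λ i' e →
      let (j' , e') = summary-nothing {ρ} {i'} e in combine-injectiveˡ i' j' i j (is-x e')

    inner-safe : I.Safe (block ρ i)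
    inner-safe = proj₁ safe i (j , ρij)

    blockBits-complete : ∀ b → blockBits (complete ρ b) ≗ complete (summary ρ) (I.bit (complete (block ρ i) b))
    blockBits-complete b i' with i' Fin.≟ i
    ... | yes refl = cong (fromMaybe _) (sym (summary-blank {ρ} {i} (j , ρij)))
    ... | no i'≢i  = trans (I.bit-cong (complete-full full b false))
                           (cong (fromMaybe _) (sym (summary-full {ρ} {i'} full)))
      where
      full : ¬ HasBlank (block ρ i')
      full (j' , e) = i'≢i (combine-injectiveˡ i' j' i j (is-x e))

    guess-last : ∀ b → guess (complete ρ b) x ≡ true
    guess-last b = cong₂ _∧_
      (trans (O.guess-cong (blockBits-complete b) i) (O.guess-last (proj₂ safe) outer-last _))
      (I.guess-last inner-safe inner-last b)

    bit-last : bit (complete ρ true) ≡ not (bit (complete ρ false))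
    bit-last = begin
      O.bit (blockBits (complete ρ true))        ≡⟨ O.bit-cong (blockBits-complete true) ⟩
      outer (innerBit true)                      ≡⟨ cong outer (I.bit-last inner-safe inner-last) ⟩
      outer (not (innerBit false))               ≡⟨ flip-not outer (O.bit-last (proj₂ safe) outer-last) _ ⟩
      not (outer (innerBit false))               ≡⟨ cong not (O.bit-cong (blockBits-complete false)) ⟨
      not (O.bit (blockBits (complete ρ false))) ∎
      where
      open ≡-Reasoning
      innerBit = I.bit ∘ complete (block ρ i)
      outer = O.bit ∘ complete (summary ρ)

  cost : (Fin N → Bool) → ℕ
  cost σ = ∑[ i < m ] (if O.guess (blockBits σ) i then count (I.guess (block σ i)) else 0)

  count-guess : ∀ σ → count (guess σ) ≡ cost σ
  count-guess σ = trans (sum-combine m (indicator ∘ guess σ)) (sum-cong-≗ λ i →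
    trans (count-cong λ j → cong (uncurry (guessAt σ)) (remQuot-combine i j))
          (count-∧ (O.guess (blockBits σ) i) (I.guess (block σ i))))

  compose : ∀ {K} → (∀ σ → cost σ ≤ K) → BitStrategy N K
  compose {K} cost≤K = record
    { Safe        = Safe
    ; safe-resp   = λ ρ≗ρ' (inner , outer) →
                      (λ i h → I.safe-resp (ρ≗ρ' ∘ combine i) (inner i (HasBlank-resp (sym ∘ ρ≗ρ' ∘ combine i) h)))
                    , O.safe-resp (λ i → summary-cong {i = i} (ρ≗ρ' ∘ combine i)) outer
    ; safe-blank  = (λ _ _ → I.safe-blank) , O.safe-resp (λ i → sym (summary-blank {blank} {i} (zero , refl))) O.safe-blank
    ; move        = move
    ; safe-move   = safe-move
    ; guess       = guess
    ; guess-cong  = λ σ≗σ' c → cong₂ _∧_ (O.guess-cong (blockBits-cong σ≗σ') (blockOf c))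
                                        (I.guess-cong (σ≗σ' ∘ combine (blockOf c)) (posOf c))
    ; bit         = bit
    ; bit-cong    = O.bit-cong ∘ blockBits-cong
    ; guess-last  = Last.guess-last
    ; bit-last    = Last.bit-last
    ; guess-size  = λ σ → subst (_≤ K) (sym (count-guess σ)) (cost≤K σ)
    }

product : ∀ {m b k₁ k₂} → BitStrategy m k₁ → BitStrategy (suc b) k₂ → BitStrategy (m * suc b) (k₁ * k₂)
product {k₂ = k₂} O I = compose λ σ →
  ℕ.≤-trans (sum-select-≤ _ _ (I.guess-size ∘ block σ)) (ℕ.*-monoˡ-≤ k₂ (O.guess-size (blockBits σ)))
  where
  open Compose O I
  module O = BitStrategy O
  module I = BitStrategy I

power : ∀ {b k} → BitStrategy (suc b) k → ∀ j → BitStrategy (suc b ^ j) (k ^ j)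
power S zero    = single
power {b} {k} S (suc j) =
  subst₂ BitStrategy (ℕ.*-comm (suc b ^ j) (suc b)) (ℕ.*-comm (k ^ j) k) (product (power S j) S)

OthersFalse : ∀ {m} → (Fin m → Bool) → Fin m → Set
OthersFalse σ i = ∀ c → c ≢ i → σ c ≡ false

othersFalse? : ∀ {m} (σ : Fin m → Bool) i → Dec (OthersFalse σ i)
othersFalse? σ i = all? λ c → ¬? (c Fin.≟ i) →-dec (σ c Bool.≟ false)

SomeTrue : ∀ {m} → (Fin m → Bool) → Set
SomeTrue σ = ∃ λ c → σ c ≡ true

someTrue? : ∀ {m} (σ : Fin m → Bool) → Dec (SomeTrue σ)
someTrue? σ = any? λ c → σ c Bool.≟ true

module Zeroes (m : ℕ) where

  NoTrue : Board m → Set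
  NoTrue ρ = ∀ c → ρ c ≢ just true

  write-false : ∀ {ρ} → NoTrue ρ → ∀ a → NoTrue (write ρ a false)
  write-false {ρ} noTrue a c with c Fin.≟ a
  ... | yes refl = λ eq → contradiction (trans (sym (write-same ρ a false)) eq) λ ()
  ... | no c≢a   = noTrue c ∘ trans (sym (write-other ρ false c≢a))

  others-false : ∀ {ρ x} → NoTrue ρ → LastBlank ρ x → ∀ b → OthersFalse (complete ρ b) x
  others-false {ρ} noTrue (_ , only) b c c≢x with ρ c in ρc
  ... | nothing    = contradiction (only c ρc) c≢x
  ... | just false = refl
  ... | just true  = contradiction ρc (noTrue c)

  bit-last : ∀ {ρ x} → NoTrue ρ → LastBlank ρ x →
             does (someTrue? (complete ρ true)) ≡ not (does (someTrue? (complete ρ false)))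
  bit-last {ρ} {x} noTrue last = trans (dec-true (someTrue? _) (x , cong (fromMaybe true) (proj₁ last)))
                                       (cong not (sym (dec-false (someTrue? _) none)))
    where
    none : ¬ SomeTrue (complete ρ false)
    none (c , true≡) with c Fin.≟ x
    ... | yes refl = contradiction (trans (sym (cong (fromMaybe false) (proj₁ last))) true≡) λ ()
    ... | no c≢x   = contradiction (trans (sym (others-false noTrue last false c c≢x)) true≡) λ ()

  strategy : BitStrategy m m
  strategy = record
    { Safe        = NoTrue
    ; safe-resp   = λ ρ≗ρ' noTrue c → noTrue c ∘ trans (ρ≗ρ' c)
    ; safe-blank  = λ _ ()
    ; move        = λ _ _ → false
    ; safe-move   = λ noTrue _ _ _ → write-false noTrue _
    ; guess       = λ σ i → does (othersFalse? σ i)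
    ; guess-cong  = λ {σ} {σ'} σ≗σ' i →
                      does-⇔ (mk⇔ (λ h c c≢i → trans (sym (σ≗σ' c)) (h c c≢i))
                                  (λ h c c≢i → trans (σ≗σ' c) (h c c≢i)))
                             (othersFalse? σ i) (othersFalse? σ' i)
    ; bit         = λ σ → does (someTrue? σ)
    ; bit-cong    = λ {σ} {σ'} σ≗σ' →
                      does-⇔ (mk⇔ (λ (c , e) → c , trans (sym (σ≗σ' c)) e)
                                  (λ (c , e) → c , trans (σ≗σ' c) e))
                             (someTrue? σ) (someTrue? σ')
    ; guess-last  = λ {ρ} {x} noTrue last b → dec-true (othersFalse? (complete ρ b) x) (others-false noTrue last b)
    ; bit-last    = bit-last
    ; guess-size  = λ σ → count≤n _
    }

stack : ∀ m {b k} (I : BitStrategy (suc b) k) → Focused I → BitStrategy (m * suc b) (m ⊔ k)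
stack m {b} {k} I focused = compose cost≤
  where
  open Compose (Zeroes.strategy m) I
  module I = BitStrategy I
  selected : (Fin (m * suc b) → Bool) → Fin m → Bool
  selected σ i = does (othersFalse? (blockBits σ) i)
  term : (Fin (m * suc b) → Bool) → Fin m → ℕ
  term σ i = if selected σ i then count (I.guess (block σ i)) else 0
  term≤k : ∀ σ i → term σ i ≤ k
  term≤k σ i with selected σ i
  ... | true  = I.guess-size (block σ i)
  ... | false = z≤n
  cost≤ : ∀ σ → cost σ ≤ m ⊔ k
  -- With a block bit 1, at most that block is selected; with none, every inner guess is a singleton.
  cost≤ σ with someTrue? (blockBits σ)
  ... | yes (i₀ , i₀-true) = begin
    cost σ     ≡⟨ sum-single (term σ) i₀ silent ⟩
    term σ i₀  ≤⟨ term≤k σ i₀ ⟩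
    k          ≤⟨ ℕ.m≤n⊔m m k ⟩
    m ⊔ k      ∎
    where
    open ℕ.≤-Reasoning
    silent : ∀ i → i ≢ i₀ → term σ i ≡ 0
    silent i i≢i₀ = cong (λ g → if g then count (I.guess (block σ i)) else 0)
      (dec-false (othersFalse? (blockBits σ) i) λ others →
        contradiction (trans (sym i₀-true) (others i₀ (i≢i₀ ∘ sym))) λ ())
  ... | no none = begin
    cost σ                  ≤⟨ sum-select-≤ (selected σ) (count ∘ I.guess ∘ block σ)
                                              (λ i → focused (block σ i) (¬-not (none ∘ (i ,_)))) ⟩
    count (selected σ) * 1  ≤⟨ ℕ.*-monoˡ-≤ 1 (count≤n (selected σ)) ⟩
    m * 1                   ≡⟨ ℕ.*-identityʳ m ⟩
    m                       ≤⟨ ℕ.m≤m⊔n m k ⟩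
    m ⊔ k                   ∎
    where open ℕ.≤-Reasoning

module Retrograde {n : ℕ} (guessᵛ : Vec Bool n → Fin n → Bool) (bitᵛ : Vec Bool n → Bool) where

  guess : (Fin n → Bool) → Fin n → Bool
  guess σ = guessᵛ (tabulate σ)

  bit : (Fin n → Bool) → Bool
  bit σ = bitᵛ (tabulate σ)

  blanks : Board n → ℕ
  blanks ρ = count (is-nothing ∘ ρ)

  splits : Vec Bool n → Vec Bool n → Fin n → Bool
  splits u v x = guessᵛ u x ∧ guessᵛ v x ∧ (bitᵛ v xor bitᵛ u)

  finishes : Board n → Fin n → Bool
  finishes ρ = splits (tabulate (complete ρ false)) (tabulate (complete ρ true))

  -- Backward induction; e is meant to be the number of blank cells of ρ.
  wins   : ℕ → Board n → Bool
  winsAt : ℕ → Board n → Fin n → Bool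

  wins zero    ρ = false
  wins (suc e) ρ = every λ a → is-just (ρ a) ∨ winsAt e ρ a

  winsAt zero    ρ a = finishes ρ a
  winsAt (suc e) ρ a = wins (suc e) (write ρ a true) ∨ wins (suc e) (write ρ a false)

  safe? : Board n → Bool
  safe? ρ = wins (blanks ρ) ρ

  wins-blank : ∀ {e} {ρ : Board n} {a} → T (wins (suc e) ρ) → ρ a ≡ nothing → T (winsAt e ρ a)
  wins-blank {e} {ρ} {a} won ρa with every-sound {p = λ a → is-just (ρ a) ∨ winsAt e ρ a} won a
  ... | won-a rewrite ρa = won-a

  blanks-cong : ∀ {ρ ρ' : Board n} → ρ ≗ ρ' → blanks ρ ≡ blanks ρ'
  blanks-cong ρ≗ρ' = count-cong (cong is-nothing ∘ ρ≗ρ')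

  finishes-cong : ∀ {ρ ρ' : Board n} → ρ ≗ ρ' → finishes ρ ≗ finishes ρ'
  finishes-cong ρ≗ρ' x = cong₂ (λ u v → splits u v x)
    (tabulate-cong (complete-cong ρ≗ρ' false)) (tabulate-cong (complete-cong ρ≗ρ' true))

  wins-cong   : ∀ e {ρ ρ' : Board n} → ρ ≗ ρ' → wins e ρ ≡ wins e ρ'
  winsAt-cong : ∀ e {ρ ρ' : Board n} → ρ ≗ ρ' → winsAt e ρ ≗ winsAt e ρ'

  wins-cong zero    ρ≗ρ' = refl
  wins-cong (suc e) ρ≗ρ' = every-cong λ a → cong₂ _∨_ (cong is-just (ρ≗ρ' a)) (winsAt-cong e ρ≗ρ' a)

  winsAt-cong zero    ρ≗ρ' a = finishes-cong ρ≗ρ' a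
  winsAt-cong (suc e) ρ≗ρ' a = cong₂ _∨_ (wins-cong (suc e) (write-cong ρ≗ρ' a true))
                                         (wins-cong (suc e) (write-cong ρ≗ρ' a false))

  safe-resp : ∀ {ρ ρ' : Board n} → ρ ≗ ρ' → T (safe? ρ) → T (safe? ρ')
  safe-resp {ρ} {ρ'} ρ≗ρ' =
    subst T (trans (cong (λ e → wins e ρ) (blanks-cong ρ≗ρ')) (wins-cong (blanks ρ') ρ≗ρ'))

  blanks-write : ∀ {ρ : Board n} {a} v → ρ a ≡ nothing → blanks ρ ≡ suc (blanks (write ρ a v))
  blanks-write {ρ} {a} v ρa = count-remove a (cong is-nothing ρa) (cong is-nothing (write-same ρ a v))
    (λ c c≢a → cong is-nothing (write-other ρ v c≢a))

  blanks-last : ∀ {ρ : Board n} {x} → LastBlank ρ x → blanks ρ ≡ 1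
  blanks-last {ρ} {x} (ρx , only) = trans (blanks-write true ρx) (cong suc (count-none filled))
    where
    filled : ∀ c → is-nothing (write ρ x true c) ≡ false
    filled c with c Fin.≟ x | ρ c in ρc
    ... | yes refl | _      = cong is-nothing (write-same ρ x true)
    ... | no c≢x   | just _ = cong is-nothing (trans (write-other ρ true c≢x) ρc)
    ... | no c≢x   | nothing = ⊥-elim (c≢x (only c ρc))

  safe-step : ∀ {ρ : Board n} {a c} → T (safe? ρ) → ρ a ≡ nothing → ρ c ≡ nothing → c ≢ a →
              T (safe? (write ρ a true)) ⊎ T (safe? (write ρ a false))
  safe-step {ρ} {a} {c} safe ρa ρc c≢a =
    Sum.map (refuel true) (refuel false)
      (T-∨ {wins (suc e) (write ρ a true)} .to (wins-blank {suc e} {ρ} won ρa))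
    where
    e = blanks (write (write ρ a true) c true)
    two : blanks ρ ≡ suc (suc e)
    two = trans (blanks-write true ρa) (cong suc (blanks-write true (trans (write-other ρ true c≢a) ρc)))
    won : T (wins (suc (suc e)) ρ)
    won = subst (λ f → T (wins f ρ)) two safe
    refuel : ∀ v → T (wins (suc e) (write ρ a v)) → T (safe? (write ρ a v))
    refuel v = subst (λ f → T (wins f (write ρ a v))) (ℕ.suc-injective (trans (sym two) (blanks-write v ρa)))

  safe-move : ∀ {ρ : Board n} {a c} → T (safe? ρ) → ρ a ≡ nothing → ρ c ≡ nothing → c ≢ a →
              T (safe? (write ρ a (safe? (write ρ a true))))
  safe-move {ρ} {a} safe ρa ρc c≢a with safe? (write ρ a true) in eq | safe-step safe ρa ρc c≢a
  ... | true  | _      = subst T (sym eq) _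
  ... | false | inj₂ t = t

  finishes-last : ∀ {ρ : Board n} {x} → T (safe? ρ) → LastBlank ρ x → T (finishes ρ x)
  finishes-last {ρ} safe last =
    wins-blank {0} {ρ} (subst (λ f → T (wins f ρ)) (blanks-last last) safe) (proj₁ last)

  finishes-sound : ∀ ρ x → T (finishes ρ x) →
                   T (guess (complete ρ false) x) × T (guess (complete ρ true) x) ×
                   bit (complete ρ true) ≡ not (bit (complete ρ false))
  finishes-sound ρ x = T-∧-∧-xor {guess (complete ρ false) x} {guess (complete ρ true) x}
                               {bit (complete ρ true)} {bit (complete ρ false)}

  guess-last : ∀ {ρ : Board n} {x} → T (safe? ρ) → LastBlank ρ x → ∀ b → guess (complete ρ b) x ≡ true
  guess-last {ρ} {x} safe last false = T-≡ .to (proj₁ (finishes-sound ρ x (finishes-last safe last)))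
  guess-last {ρ} {x} safe last true  = T-≡ .to (proj₁ (proj₂ (finishes-sound ρ x (finishes-last safe last))))

  bit-last : ∀ {ρ : Board n} {x} → T (safe? ρ) → LastBlank ρ x →
             bit (complete ρ true) ≡ not (bit (complete ρ false))
  bit-last {ρ} {x} safe last = proj₂ (proj₂ (finishes-sound ρ x (finishes-last safe last)))

  strategy : ∀ {k} → T (safe? blank) → (∀ v → count (guessᵛ v) ≤ k) → BitStrategy n k
  strategy safe-blank size = record
    { Safe        = T ∘ safe?
    ; safe-resp   = safe-resp
    ; safe-blank  = safe-blank
    ; move        = λ ρ a → safe? (write ρ a true)
    ; safe-move   = safe-move
    ; guess       = guess
    ; guess-cong  = λ σ≗σ' x → cong (λ v → guessᵛ v x) (tabulate-cong σ≗σ')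
    ; bit         = bit
    ; bit-cong    = cong bitᵛ ∘ tabulate-cong
    ; guess-last  = guess-last
    ; bit-last    = bit-last
    ; guess-size  = size ∘ tabulate
    }

-- The codewords of Bob's 6-cell strategy, each with the directions in which it is marked.
marks : Vec Bool 6 → List (Fin 6)
marks (true  ∷ true  ∷ false ∷ true  ∷ false ∷ false ∷ []) = 0F ∷ 1F ∷ 3F ∷ 4F ∷ 5F ∷ []
marks (false ∷ false ∷ true  ∷ true  ∷ false ∷ false ∷ []) = 0F ∷ 1F ∷ 3F ∷ 4F ∷ 5F ∷ []
marks (false ∷ true  ∷ false ∷ false ∷ true  ∷ false ∷ []) = 2F ∷ 3F ∷ 4F ∷ 5F ∷ []
marks (true  ∷ false ∷ true  ∷ false ∷ true  ∷ false ∷ []) = 1F ∷ 2F ∷ 3F ∷ 4F ∷ 5F ∷ []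
marks (false ∷ false ∷ false ∷ true  ∷ true  ∷ false ∷ []) = 4F ∷ []
marks (true  ∷ true  ∷ true  ∷ true  ∷ true  ∷ false ∷ []) = 4F ∷ []
marks (false ∷ false ∷ false ∷ false ∷ false ∷ true  ∷ []) = 0F ∷ 2F ∷ 3F ∷ 4F ∷ 5F ∷ []
marks (true  ∷ true  ∷ true  ∷ false ∷ false ∷ true  ∷ []) = 0F ∷ 1F ∷ 2F ∷ 3F ∷ 5F ∷ []
marks (false ∷ false ∷ true  ∷ false ∷ true  ∷ true  ∷ []) = 1F ∷ []
marks (true  ∷ false ∷ false ∷ true  ∷ true  ∷ true  ∷ []) = 0F ∷ 1F ∷ 2F ∷ 3F ∷ 4F ∷ []
marks (false ∷ true  ∷ true  ∷ true  ∷ true  ∷ true  ∷ []) = 0F ∷ 1F ∷ 2F ∷ 4F ∷ 5F ∷ []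
marks _                                                    = []

marked : Vec Bool 6 → Fin 6 → Bool
marked v x = does (x ∈? marks v)

sixGuess : Vec Bool 6 → Fin 6 → Bool
sixGuess v x = marked v x ∨ marked (v [ x ]%= not) x

sixBit : Vec Bool 6 → Bool
sixBit v = not (null (marks v))

six-size : ∀ v → count (sixGuess v) ≤ 5
six-size v = ℕ.≤ᵇ⇒≤ _ 5 (everyVec-sound {P = λ v → count (sixGuess v) ≤ᵇ 5} _ v)

six : BitStrategy 6 5
six = Retrograde.strategy sixGuess sixBit _ six-size

six-focused : Focused six
six-focused σ bit≡false = ℕ.≤ᵇ⇒≤ _ 1 (subst (λ b → T (b ∨ (count (sixGuess (tabulate σ)) ≤ᵇ 1))) bit≡false
  (everyVec-sound {P = λ v → sixBit v ∨ (count (sixGuess v) ≤ᵇ 1)} _ (tabulate σ)))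

thirty : BitStrategy 30 5
thirty = stack 5 six six-focused

private
  bernoulli-identity : ∀ M q X → suc M * ((M + q) * X) ≡ (M + suc q) * (M * X) + q * X
  bernoulli-identity = solve-∀

  exponent-identity : ∀ q r → suc (q + r) ≡ r + 1 + q
  exponent-identity = solve-∀

bernoulli : ∀ M q → (M + q) * M ^ q ≤ M * suc M ^ q
bernoulli M zero    = ℕ.≤-reflexive (cong (_* 1) (ℕ.+-identityʳ M))
bernoulli M (suc q) = begin
  (M + suc q) * (M * M ^ q)              ≤⟨ ℕ.m≤m+n _ (q * M ^ q) ⟩
  (M + suc q) * (M * M ^ q) + q * M ^ q  ≡⟨ bernoulli-identity M q (M ^ q) ⟨
  suc M * ((M + q) * M ^ q)              ≤⟨ ℕ.*-monoʳ-≤ (suc M) (bernoulli M q) ⟩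
  suc M * (M * suc M ^ q)                ≡⟨ x∙yz≈y∙xz (suc M) M _ ⟩
  M * suc M ^ suc q                      ∎
  where open ℕ.≤-Reasoning

bernoulli′ : ∀ c M .{{_ : NonZero M}} → suc c * M ^ (c * M) ≤ suc M ^ (c * M)
bernoulli′ c M = ℕ.*-cancelˡ-≤ M (begin
  M * (suc c * M ^ q)   ≡⟨ x∙yz≈xy∙z M (suc c) (M ^ q) ⟩
  M * suc c * M ^ q     ≡⟨ cong (_* M ^ q) (ℕ.*-comm M (suc c)) ⟩
  (M + c * M) * M ^ q   ≤⟨ bernoulli M q ⟩
  M * suc M ^ q         ∎)
  where
  open ℕ.≤-Reasoning
  q = c * M

-- BelowBound (5^(j+1)) n asks for j < p/q ≤ log₃₀ n.  Take p/q = j + 1/q: this needs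
-- 30 ≤ ((M+1)/M)^q where M = 30^j < n, and by Bernoulli's inequality q = 29M suffices.
below-bound : ∀ j {n} → 30 ^ j < n → BelowBound (5 ^ suc j) n
below-bound j {n} 30^j<n = p , q , 1≤q , k^q<5^[p+q] , 30^p≤n^q
  where
  M = 30 ^ j
  instance
    M≢0 : NonZero M
    M≢0 = ℕ.m^n≢0 30 j
  q = 29 * M
  p = j * q + 1
  1≤q : 1 ≤ q
  1≤q = ℕ.*-mono-≤ {1} {29} (s≤s z≤n) (ℕ.m^n>0 30 j)
  k^q<5^[p+q] : (5 ^ suc j) ^ q < 5 ^ (p + q)
  k^q<5^[p+q] = begin-strict
    (5 ^ suc j) ^ q  ≡⟨ ℕ.^-*-assoc 5 (suc j) q ⟩
    5 ^ (q + j * q)  <⟨ ℕ.^-monoʳ-< 5 (s≤s (s≤s z≤n)) (ℕ.≤-reflexive (exponent-identity q (j * q))) ⟩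
    5 ^ (p + q)      ∎
    where open ℕ.≤-Reasoning
  30^p≤n^q : 30 ^ p ≤ n ^ q
  30^p≤n^q = begin
    30 ^ (j * q + 1)      ≡⟨ ℕ.^-distribˡ-+-* 30 (j * q) 1 ⟩
    30 ^ (j * q) * 30 ^ 1 ≡⟨ cong₂ _*_ (sym (ℕ.^-*-assoc 30 j q)) (ℕ.*-identityʳ 30) ⟩
    M ^ q * 30            ≡⟨ ℕ.*-comm (M ^ q) 30 ⟩
    30 * M ^ q            ≤⟨ bernoulli′ 29 M ⟩
    suc M ^ q             ≤⟨ ℕ.^-monoˡ-≤ q 30^j<n ⟩
    n ^ q                 ∎
    where open ℕ.≤-Reasoning

suc≤* : ∀ B .{{_ : NonTrivial B}} {x} → 0 < x → suc x ≤ B * x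
suc≤* B {x} 0<x = begin
  suc x   ≤⟨ ℕ.+-monoˡ-≤ x 0<x ⟩
  x + x   ≡⟨ cong (x +_) (sym (ℕ.+-identityʳ x)) ⟩
  2 * x   ≤⟨ ℕ.*-monoˡ-≤ x (nonTrivial⇒n>1 B) ⟩
  B * x   ∎
  where open ℕ.≤-Reasoning

power-bracket : ∀ B .{{_ : NonTrivial B}} n → ∃ λ j → B ^ j < 2 + n × 2 + n ≤ B ^ suc j
power-bracket B zero    = 0 , s≤s (s≤s z≤n) , subst (2 ≤_) (sym (ℕ.*-identityʳ B)) (nonTrivial⇒n>1 B)
power-bracket B (suc n) with power-bracket B n
... | j , lower , upper with ℕ.m≤n⇒m<n∨m≡n upper
... | inj₁ below = j , ℕ.m<n⇒m<1+n lower , below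
... | inj₂ equal = suc j , ℕ.≤-reflexive (cong suc (sym equal))
                         , subst (λ x → 3 + n ≤ B * x) equal (suc≤* B (s≤s z≤n))

corollary1 : ∀ (n : ℕ) → 1 ≤ n → ∃[ k ] (KNStrategy k n × BelowBound k n)
corollary1 (suc zero)    _ = 1 , toKNStrategy single , 0 , 1 , ℕ.≤-refl , s≤s (s≤s z≤n) , ℕ.≤-refl
corollary1 (suc (suc n)) _ with power-bracket 30 n
... | j , lower , upper =
  5 ^ suc j , toKNStrategy (restrict upper (power thirty (suc j))) , below-bound j lower
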